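{- For a positive integer $n$, the $2\times n$ grid has twin-width $2$ if and only if $n\geq 4$.
   Context: The $m\times n$ grid has vertex set $\{(i,j)\in\mathbb{Z}^2:1\le i\le m,1\le j\le n\}$ with $(i,j),(i',j')$ adjacent iff $|i-i'|+|j-j'|=1$. Twin-width: for a trigraph (vertex set with disjoint black and red edge sets; a graph has no red edges), contracting distinct $u,v$ gives a new vertex $x$ with $xy$ black if $uy,vy$ both black, absent if neither is an edge, red otherwise; twin-width is the least $d$ such that some sequence of contractions down to one vertex keeps every trigraph's maximum red degree at most $d$. -}

module Defs where

open import Data.Nat using (ℕ; zero; suc; _+_; _*_; _≤_; ∣_-_∣; _≡ᵇ_)
open import Data.Fin using (Fin; toℕ; remQuot; punchIn; _≟_)
open import Data.Product using (_×_; _,_; proj₁; proj₂)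
open import Data.Bool using (Bool; true; false; if_then_else_)
open import Data.List using (map)
open import Data.Nat.ListAction using (sum)
open import Data.List.Base using (allFin)
open import Relation.Nullary using (¬_; yes; no)
open import Relation.Binary.PropositionalEquality using (_≡_; _≢_)

data Col : Set where
  none black red : Col

-- A trigraph on vertex set Fin k: for each pair of vertices, whether they
-- are non-adjacent, joined by a black edge, or joined by a red edge.
-- (Only off-diagonal entries are ever used.)
Trigraph : ℕ → Set
Trigraph k = Fin k → Fin k → Col

-- Colour of xy after contracting u,v into x, given colours of uy and vy.
merge : Col → Col → Col
merge black black = black
merge none  none  = none
merge _     _     = red

-- The result has vertex
-- set Fin (k+1), identified with Fin (k+2) minus v via punchIn v; the vertex
-- corresponding to u plays the role of the new vertex x.
contract : ∀ {k} → Trigraph (suc (suc k)) → (u v : Fin (suc (suc k))) → Trigraph (suc k)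
contract t u v a b with punchIn v a ≟ u | punchIn v b ≟ u
... | yes _ | yes _ = none
... | yes _ | no _  = merge (t u (punchIn v b)) (t v (punchIn v b))
... | no _  | yes _ = merge (t (punchIn v a) u) (t (punchIn v a) v)
... | no _  | no _  = t (punchIn v a) (punchIn v b)

isRed : Col → Bool
isRed red = true
isRed _   = false

redDeg : ∀ {k} → Trigraph k → Fin k → ℕ
redDeg {k} t a = sum (map (λ b → count b) (allFin k))
  where
  count : Fin k → ℕ
  count b with a ≟ b
  ... | yes _ = 0
  ... | no _  = if isRed (t a b) then 1 else 0

MaxRedDegAtMost : ∀ {k} → ℕ → Trigraph k → Set
MaxRedDegAtMost d t = ∀ a → redDeg t a ≤ d

data ContractionSeq (d : ℕ) : ∀ {k} → Trigraph k → Set where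
  done : (t : Trigraph 1) → MaxRedDegAtMost d t → ContractionSeq d t
  step : ∀ {k} (t : Trigraph (suc (suc k))) (u v : Fin (suc (suc k))) → u ≢ v →
         MaxRedDegAtMost d t → ContractionSeq d (contract t u v) → ContractionSeq d t

TwwAtMost : ∀ {k} → ℕ → Trigraph k → Set
TwwAtMost d t = ContractionSeq d t

TwinWidthIs : ∀ {k} → Trigraph k → ℕ → Set
TwinWidthIs t zero    = TwwAtMost zero t
TwinWidthIs t (suc d) = TwwAtMost (suc d) t × ¬ TwwAtMost d t

-- The m × n grid as a graph (trigraph with no red edges) on Fin (m * n);
-- vertex w corresponds to (i , j) = remQuot n w, i.e. row i+1, column j+1.
grid : (m n : ℕ) → Trigraph (m * n)
grid m n w w' with remQuot {m} n w | remQuot {m} n w'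
... | (i , j) | (i' , j') =
  if (∣ toℕ i - toℕ i' ∣ + ∣ toℕ j - toℕ j' ∣) ≡ᵇ 1 then black else none

-- Upper bound: the 2 × n grid sits inside the headed ladder, a ladder read column by column
-- together with a head vertex joined in red to its first two positions.  Merging the head
-- with the first position leaves a shorter headed ladder (with the parity of its rungs
-- flipped), and red degrees never exceed 2.  Lower bound: a contraction sequence of G
-- restricts to any H embedded in G with red edges allowed to grow (contractions touching at
-- most one vertex of H are skipped), so twin-width is monotone; it then suffices that the
-- 2 × 4 grid has no 1-contraction sequence.  This, like the 1-sequences of the 2 × n grids
-- for n ≤ 3, is settled by exhaustive search.
module Submission where

open import Defs
open import Data.Nat using (ℕ; _≤_)
open import Function.Bundles using (_⇔_; mk⇔)
open import Data.Nat using (zero; suc; _+_; _*_; _<_; z≤n; s≤s; z<s; s<s; ∣_-_∣; _≡ᵇ_; _≤?_)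
open import Data.Nat.Properties
  using (≤-refl; ≤-trans; *-comm; ≮⇒≥; +-mono-≤; +-0-commutativeMonoid; module ≤-Reasoning)
open import Data.Fin using (Fin; zero; suc; _≟_; toℕ; punchIn; punchOut; remQuot; combine; inject≤)
open import Data.Fin.Properties
  using (any?; all?; 0≢1+n; suc-injective; punchIn-punchOut; punchOut-injective; punchIn-injective;
         punchInᵢ≢i; punchOut-punchIn; punchOut-cong; remQuot-combine; combine-remQuot; toℕ-combine;
         combine-injective; toℕ-inject≤; inject≤-injective)
open import Data.Bool using (Bool; true; false; not; if_then_else_)
open import Data.List using (map; tabulate)
open import Data.List.Base using (allFin)
open import Data.List.Properties using (map-tabulate)
open import Data.Nat.ListAction using (sum)
open import Data.Empty using (⊥; ⊥-elim)
open import Data.Sum using (_⊎_; inj₁; inj₂)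
open import Data.Product using (_×_; _,_; uncurry)
import Data.Product as Product
open import Function using (_∘_; id)
open import Function.Definitions using (Injective)
open import Relation.Nullary using (¬_; ¬?; Dec; yes; no)
open import Relation.Nullary.Decidable using (_⊎-dec_; _×-dec_; map′; toWitness; toWitnessFalse)
open import Relation.Binary.PropositionalEquality
open import Algebra.Properties.CommutativeMonoid.Sum +-0-commutativeMonoid
  using (sum-cong-≗) renaming (sum to ∑; sum-remove to ∑-remove)

sum-tabulate : ∀ {k} (f : Fin k → ℕ) → sum (tabulate f) ≡ ∑ f
sum-tabulate {zero}  f = refl
sum-tabulate {suc k} f = cong (f zero +_) (sum-tabulate (f ∘ suc))

sum-allFin : ∀ {k} {f g : Fin k → ℕ} → f ≗ g → sum (map f (allFin k)) ≡ ∑ g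
sum-allFin {f = f} f≗g = trans (cong sum (map-tabulate id f)) (trans (sum-tabulate f) (sum-cong-≗ f≗g))

∑-≤-injective : ∀ {j k} {f : Fin j → ℕ} {g : Fin k → ℕ} (ι : Fin j → Fin k) →
                Injective _≡_ _≡_ ι → (∀ a → f a ≤ g (ι a)) → ∑ f ≤ ∑ g
∑-≤-injective {zero}          ι _ _ = z≤n
∑-≤-injective {suc j} {zero}  ι _ _ with ι zero
... | ()
∑-≤-injective {suc j} {suc k} {f} {g} ι ι-inj f≤g = begin
  f zero + ∑ (f ∘ suc)                 ≤⟨ +-mono-≤ (f≤g zero) (∑-≤-injective ι′ ι′-inj f≤g∘ι′) ⟩
  g (ι zero) + ∑ (g ∘ punchIn (ι zero)) ≡⟨ ∑-remove g ⟨
  ∑ g                                  ∎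
  where
  open ≤-Reasoning
  ι0≢ι : ∀ a → ι zero ≢ ι (suc a)
  ι0≢ι a = 0≢1+n ∘ ι-inj
  ι′ : Fin j → Fin k
  ι′ a = punchOut (ι0≢ι a)
  ι′-inj : Injective _≡_ _≡_ ι′
  ι′-inj = suc-injective ∘ ι-inj ∘ punchOut-injective (ι0≢ι _) (ι0≢ι _)
  f≤g∘ι′ : ∀ a → f (suc a) ≤ g (punchIn (ι zero) (ι′ a))
  f≤g∘ι′ a = subst (λ b → f (suc a) ≤ g b) (sym (punchIn-punchOut (ι0≢ι a))) (f≤g (suc a))

∑-≤-window : ∀ {k} lo w (g : Fin k → ℕ) → (∀ c → g c ≤ 1) →
             (∀ c → toℕ c < lo ⊎ lo + w ≤ toℕ c → g c ≡ 0) → ∑ g ≤ w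
∑-≤-window {zero}  _        _       _ _   _       = z≤n
∑-≤-window {suc k} (suc lo) w       g g≤1 outside rewrite outside zero (inj₁ z<s) =
  ∑-≤-window lo w (g ∘ suc) (g≤1 ∘ suc) λ where
    c (inj₁ c<lo)   → outside (suc c) (inj₁ (s<s c<lo))
    c (inj₂ lo+w≤c) → outside (suc c) (inj₂ (s≤s lo+w≤c))
∑-≤-window {suc k} zero     zero    g g≤1 outside rewrite outside zero (inj₂ z≤n) =
  ∑-≤-window zero zero (g ∘ suc) (g≤1 ∘ suc) λ c _ → outside (suc c) (inj₂ z≤n)
∑-≤-window {suc k} zero     (suc w) g g≤1 outside =
  +-mono-≤ (g≤1 zero) (∑-≤-window zero w (g ∘ suc) (g≤1 ∘ suc) λ where
    c (inj₂ w≤c) → outside (suc c) (inj₂ (s≤s w≤c)))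

infix 4 _⊑_

data _⊑_ : Col → Col → Set where
  ⊑-refl : ∀ {c} → c ⊑ c
  ⊑-red  : ∀ {c} → c ⊑ red

≡⇒⊑ : ∀ {c d} → c ≡ d → c ⊑ d
≡⇒⊑ refl = ⊑-refl

⊑-trans : ∀ {c d e} → c ⊑ d → d ⊑ e → c ⊑ e
⊑-trans c⊑d ⊑-refl = c⊑d
⊑-trans _   ⊑-red  = ⊑-red

merge-upperˡ : ∀ c d → c ⊑ merge c d
merge-upperˡ none  none  = ⊑-refl
merge-upperˡ none  black = ⊑-red
merge-upperˡ none  red   = ⊑-red
merge-upperˡ black none  = ⊑-red
merge-upperˡ black black = ⊑-refl
merge-upperˡ black red   = ⊑-red
merge-upperˡ red   _     = ⊑-red

merge-upperʳ : ∀ c d → d ⊑ merge c d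
merge-upperʳ none  none  = ⊑-refl
merge-upperʳ none  black = ⊑-red
merge-upperʳ none  red   = ⊑-red
merge-upperʳ black none  = ⊑-red
merge-upperʳ black black = ⊑-refl
merge-upperʳ black red   = ⊑-red
merge-upperʳ red   _     = ⊑-red

merge-mono : ∀ {c₁ c₂ d₁ d₂} → c₁ ⊑ d₁ → c₂ ⊑ d₂ → merge c₁ c₂ ⊑ merge d₁ d₂
merge-mono           ⊑-refl ⊑-refl = ⊑-refl
merge-mono           ⊑-red  _      = ⊑-red
merge-mono {none}    ⊑-refl ⊑-red  = ⊑-red
merge-mono {black}   ⊑-refl ⊑-red  = ⊑-red
merge-mono {red}     ⊑-refl ⊑-red  = ⊑-red

redWeight : Col → ℕ
redWeight c = if isRed c then 1 else 0

redWeight≤1 : ∀ c → redWeight c ≤ 1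
redWeight≤1 none  = z≤n
redWeight≤1 black = z≤n
redWeight≤1 red   = ≤-refl

redWeight-mono : ∀ {c d} → c ⊑ d → redWeight c ≤ redWeight d
redWeight-mono     ⊑-refl = ≤-refl
redWeight-mono {c} ⊑-red  = redWeight≤1 c

redIndicator : ∀ {k} → Trigraph k → Fin k → Fin k → ℕ
redIndicator t a b with a ≟ b
... | yes _ = 0
... | no _  = redWeight (t a b)

-- The left-hand side is the counting function local to redDeg, which cannot be named;
-- it is inferred from the use in redDeg≡∑ (hence the forward declaration).
count≡redIndicator : ∀ {k} (t : Trigraph k) a b → _ ≡ redIndicator t a b

redDeg≡∑ : ∀ {k} (t : Trigraph k) a → redDeg t a ≡ ∑ (redIndicator t a)
redDeg≡∑ t a = sum-allFin (count≡redIndicator t a)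

count≡redIndicator t a b with a ≟ b
... | yes _ = refl
... | no _  = refl

redIndicator≤1 : ∀ {k} (t : Trigraph k) a b → redIndicator t a b ≤ 1
redIndicator≤1 t a b with a ≟ b
... | yes _ = z≤n
... | no _  = redWeight≤1 (t a b)

redIndicator-self : ∀ {k} (t : Trigraph k) a → redIndicator t a a ≡ 0
redIndicator-self t a with a ≟ a
... | yes _   = refl
... | no a≢a = ⊥-elim (a≢a refl)

redIndicator-nonRed : ∀ {k} (t : Trigraph k) a b → isRed (t a b) ≡ false → redIndicator t a b ≡ 0
redIndicator-nonRed t a b ab-nonRed with a ≟ b
... | yes _ = refl
... | no _  rewrite ab-nonRed = refl

infix 4 _↪_

record _↪_ {j k} (H : Trigraph j) (G : Trigraph k) : Set where
  field
    vertex    : Fin j → Fin k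
    injective : Injective _≡_ _≡_ vertex
    dominated : ∀ {a b} → a ≢ b → H a b ⊑ G (vertex a) (vertex b)

open _↪_

redDeg-↪ : ∀ {j k} {H : Trigraph j} {G : Trigraph k} (e : H ↪ G) a → redDeg H a ≤ redDeg G (vertex e a)
redDeg-↪ {H = H} {G} e a = begin
  redDeg H a                          ≡⟨ redDeg≡∑ H a ⟩
  ∑ (redIndicator H a)                ≤⟨ ∑-≤-injective (vertex e) (injective e) indicator-≤ ⟩
  ∑ (redIndicator G (vertex e a))     ≡⟨ redDeg≡∑ G (vertex e a) ⟨
  redDeg G (vertex e a)               ∎
  where
  open ≤-Reasoning
  indicator-≤ : ∀ b → redIndicator H a b ≤ redIndicator G (vertex e a) (vertex e b)
  indicator-≤ b with a ≟ b
  ... | yes _ = z≤n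
  ... | no a≢b with vertex e a ≟ vertex e b
  ...   | yes ea≡eb = ⊥-elim (a≢b (injective e ea≡eb))
  ...   | no _      = redWeight-mono (dominated e a≢b)

maxRedDeg-↪ : ∀ {d j k} {H : Trigraph j} {G : Trigraph k} →
              H ↪ G → MaxRedDegAtMost d G → MaxRedDegAtMost d H
maxRedDeg-↪ e G≤d a = ≤-trans (redDeg-↪ e a) (G≤d (vertex e a))

module Contraction {k} {u v : Fin (suc (suc k))} (u≢v : u ≢ v) where

  -- contract t u v names its vertices by punchIn v, the merged vertex being the name of u;
  -- collapse p is the vertex of contract t u v that p ends up in.
  collapse : Fin (suc (suc k)) → Fin (suc k)
  collapse p with v ≟ p
  ... | yes _   = punchOut (u≢v ∘ sym)
  ... | no v≢p = punchOut v≢p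

  Merged : Fin (suc (suc k)) → Set
  Merged p = p ≡ u ⊎ p ≡ v

  merged? : ∀ p → Dec (Merged p)
  merged? p = (p ≟ u) ⊎-dec (p ≟ v)

  punchIn-collapse : ∀ {p} → p ≢ v → punchIn v (collapse p) ≡ p
  punchIn-collapse {p} p≢v with v ≟ p
  ... | yes v≡p = ⊥-elim (p≢v (sym v≡p))
  ... | no v≢p  = punchIn-punchOut v≢p

  punchIn-collapse-merged : ∀ {p} → Merged p → punchIn v (collapse p) ≡ u
  punchIn-collapse-merged (inj₁ refl) = punchIn-collapse u≢v
  punchIn-collapse-merged (inj₂ refl) with v ≟ v
  ... | yes _   = punchIn-punchOut (u≢v ∘ sym)
  ... | no v≢v = ⊥-elim (v≢v refl)

  collapse-punchIn : ∀ q → collapse (punchIn v q) ≡ q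
  collapse-punchIn q with v ≟ punchIn v q
  ... | yes v≡q̂ = ⊥-elim (punchInᵢ≢i v q (sym v≡q̂))
  ... | no _    = trans (punchOut-cong v refl) (punchOut-punchIn v)

  collapse-merged : ∀ {p q} → Merged p → Merged q → collapse p ≡ collapse q
  collapse-merged mp mq = punchIn-injective v _ _
    (trans (punchIn-collapse-merged mp) (sym (punchIn-collapse-merged mq)))

  collapse-injective : ∀ {p q} → collapse p ≡ collapse q → p ≡ q ⊎ (Merged p × Merged q)
  collapse-injective {p} {q} eq with v ≟ p | v ≟ q
  ... | yes v≡p | yes v≡q = inj₁ (trans (sym v≡p) v≡q)
  ... | yes v≡p | no _    = inj₂ (inj₂ (sym v≡p) , inj₁ (sym (punchOut-injective {i = v} _ _ eq)))
  ... | no _    | yes v≡q = inj₂ (inj₁ (punchOut-injective {i = v} _ _ eq) , inj₂ (sym v≡q))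
  ... | no _    | no _    = inj₁ (punchOut-injective {i = v} _ _ eq)

  unmerged-punchIn : ∀ {p} → ¬ Merged p → punchIn v (collapse p) ≢ u
  unmerged-punchIn ¬mp p̂≡u = ¬mp (inj₁ (trans (sym (punchIn-collapse (¬mp ∘ inj₂))) p̂≡u))

  contract-unmerged : ∀ t {p q} → ¬ Merged p → ¬ Merged q →
                      contract t u v (collapse p) (collapse q) ≡ t p q
  contract-unmerged t {p} {q} ¬mp ¬mq
    with punchIn v (collapse p) ≟ u | punchIn v (collapse q) ≟ u
  ... | yes p̂≡u | _       = ⊥-elim (unmerged-punchIn ¬mp p̂≡u)
  ... | no _    | yes q̂≡u = ⊥-elim (unmerged-punchIn ¬mq q̂≡u)
  ... | no _    | no _    = cong₂ t (punchIn-collapse (¬mp ∘ inj₂)) (punchIn-collapse (¬mq ∘ inj₂))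

  contract-mergedˡ : ∀ t {p q} → Merged p → ¬ Merged q →
                     contract t u v (collapse p) (collapse q) ≡ merge (t u q) (t v q)
  contract-mergedˡ t {p} {q} mp ¬mq
    with punchIn v (collapse p) ≟ u | punchIn v (collapse q) ≟ u
  ... | no p̂≢u | _       = ⊥-elim (p̂≢u (punchIn-collapse-merged mp))
  ... | yes _   | yes q̂≡u = ⊥-elim (unmerged-punchIn ¬mq q̂≡u)
  ... | yes _   | no _    = cong (λ r → merge (t u r) (t v r)) (punchIn-collapse (¬mq ∘ inj₂))

  contract-mergedʳ : ∀ t {p q} → ¬ Merged p → Merged q →
                     contract t u v (collapse p) (collapse q) ≡ merge (t p u) (t p v)
  contract-mergedʳ t {p} {q} ¬mp mq
    with punchIn v (collapse p) ≟ u | punchIn v (collapse q) ≟ u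
  ... | yes p̂≡u | _       = ⊥-elim (unmerged-punchIn ¬mp p̂≡u)
  ... | no _    | no q̂≢u  = ⊥-elim (q̂≢u (punchIn-collapse-merged mq))
  ... | no _    | yes _   = cong (λ r → merge (t r u) (t r v)) (punchIn-collapse (¬mp ∘ inj₂))

  contract-dominates : ∀ t {p q} → collapse p ≢ collapse q → t p q ⊑ contract t u v (collapse p) (collapse q)
  contract-dominates t {p} {q} p≁q with merged? p | merged? q
  ... | yes mp          | yes mq = ⊥-elim (p≁q (collapse-merged mp mq))
  ... | yes (inj₁ refl) | no ¬mq = ⊑-trans (merge-upperˡ _ _) (≡⇒⊑ (sym (contract-mergedˡ t (inj₁ refl) ¬mq)))
  ... | yes (inj₂ refl) | no ¬mq = ⊑-trans (merge-upperʳ _ _) (≡⇒⊑ (sym (contract-mergedˡ t (inj₂ refl) ¬mq)))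
  ... | no ¬mp | yes (inj₁ refl) = ⊑-trans (merge-upperˡ _ _) (≡⇒⊑ (sym (contract-mergedʳ t ¬mp (inj₁ refl))))
  ... | no ¬mp | yes (inj₂ refl) = ⊑-trans (merge-upperʳ _ _) (≡⇒⊑ (sym (contract-mergedʳ t ¬mp (inj₂ refl))))
  ... | no ¬mp | no ¬mq          = ≡⇒⊑ (sym (contract-unmerged t ¬mp ¬mq))

↪-contract-unhit : ∀ {j k} {H : Trigraph j} {G : Trigraph (suc (suc k))} {u v} →
                   (e : H ↪ G) (u≢v : u ≢ v) → (∀ {a b} → vertex e a ≡ u → vertex e b ≡ v → ⊥) →
                   H ↪ contract G u v
↪-contract-unhit {G = G} {u} {v} e u≢v not-both = record
  { vertex    = collapse ∘ vertex e
  ; injective = injective′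
  ; dominated = λ a≢b → ⊑-trans (dominated e a≢b) (contract-dominates G (a≢b ∘ injective′))
  }
  where
  open Contraction u≢v
  injective′ : Injective _≡_ _≡_ (collapse ∘ vertex e)
  injective′ eq with collapse-injective eq
  ... | inj₁ ea≡eb                = injective e ea≡eb
  ... | inj₂ (inj₁ ea≡u , inj₁ eb≡u) = injective e (trans ea≡u (sym eb≡u))
  ... | inj₂ (inj₁ ea≡u , inj₂ eb≡v) = ⊥-elim (not-both ea≡u eb≡v)
  ... | inj₂ (inj₂ ea≡v , inj₁ eb≡u) = ⊥-elim (not-both eb≡u ea≡v)
  ... | inj₂ (inj₂ ea≡v , inj₂ eb≡v) = injective e (trans ea≡v (sym eb≡v))

module ContractHit {j k} {H : Trigraph (suc (suc j))} {G : Trigraph (suc (suc k))} {a₀ b₀}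
                   (e : H ↪ G) (u≢v : vertex e a₀ ≢ vertex e b₀) where

  module H = Contraction (u≢v ∘ cong (vertex e))
  module G = Contraction u≢v

  merged-↪ : ∀ {p} → H.Merged p → G.Merged (vertex e p)
  merged-↪ (inj₁ refl) = inj₁ refl
  merged-↪ (inj₂ refl) = inj₂ refl

  unmerged-↪ : ∀ {p} → ¬ H.Merged p → ¬ G.Merged (vertex e p)
  unmerged-↪ ¬mp (inj₁ ep≡u) = ¬mp (inj₁ (injective e ep≡u))
  unmerged-↪ ¬mp (inj₂ ep≡v) = ¬mp (inj₂ (injective e ep≡v))

  contract-collapse-dominated :
    ∀ {p q} → H.collapse p ≢ H.collapse q →
    contract H a₀ b₀ (H.collapse p) (H.collapse q) ⊑
    contract G (vertex e a₀) (vertex e b₀) (G.collapse (vertex e p)) (G.collapse (vertex e q))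
  contract-collapse-dominated {p} {q} p≁q with H.merged? p | H.merged? q
  ... | yes mp | yes mq = ⊥-elim (p≁q (H.collapse-merged mp mq))
  ... | yes mp | no ¬mq = subst₂ _⊑_
          (sym (H.contract-mergedˡ H mp ¬mq)) (sym (G.contract-mergedˡ G (merged-↪ mp) (unmerged-↪ ¬mq)))
          (merge-mono (dominated e (¬mq ∘ inj₁ ∘ sym)) (dominated e (¬mq ∘ inj₂ ∘ sym)))
  ... | no ¬mp | yes mq = subst₂ _⊑_
          (sym (H.contract-mergedʳ H ¬mp mq)) (sym (G.contract-mergedʳ G (unmerged-↪ ¬mp) (merged-↪ mq)))
          (merge-mono (dominated e (¬mp ∘ inj₁)) (dominated e (¬mp ∘ inj₂)))
  ... | no ¬mp | no ¬mq = subst₂ _⊑_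
          (sym (H.contract-unmerged H ¬mp ¬mq)) (sym (G.contract-unmerged G (unmerged-↪ ¬mp) (unmerged-↪ ¬mq)))
          (dominated e (p≁q ∘ cong H.collapse))

  ρ : Fin (suc j) → Fin (suc k)
  ρ c = G.collapse (vertex e (punchIn b₀ c))

  ρ-injective : Injective _≡_ _≡_ ρ
  ρ-injective {c} {c′} eq with G.collapse-injective eq
  ... | inj₁ ep≡ep′    = punchIn-injective b₀ c c′ (injective e ep≡ep′)
  ... | inj₂ (mp , mp′) = punchIn-injective b₀ c c′ (trans (merged-at-a₀ c mp) (sym (merged-at-a₀ c′ mp′)))
    where
    merged-at-a₀ : ∀ c → G.Merged (vertex e (punchIn b₀ c)) → punchIn b₀ c ≡ a₀
    merged-at-a₀ c (inj₁ ep≡u) = injective e ep≡u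
    merged-at-a₀ c (inj₂ ep≡v) = ⊥-elim (punchInᵢ≢i b₀ c (injective e ep≡v))

  ↪-contract-hit : contract H a₀ b₀ ↪ contract G (vertex e a₀) (vertex e b₀)
  ↪-contract-hit = record
    { vertex    = ρ
    ; injective = ρ-injective
    ; dominated = λ {c} {c′} c≢c′ →
        subst₂ (λ x y → contract H a₀ b₀ x y ⊑ contract G (vertex e a₀) (vertex e b₀) (ρ c) (ρ c′))
          (H.collapse-punchIn c) (H.collapse-punchIn c′)
          (contract-collapse-dominated (c≢c′ ∘ subst₂ _≡_ (H.collapse-punchIn c) (H.collapse-punchIn c′)))
    }

open ContractHit using (↪-contract-hit)

Fin1-unique : (a b : Fin 1) → a ≡ b
Fin1-unique zero zero = refl

↪-contractionSeq : ∀ {d j k} {H : Trigraph (suc j)} {G : Trigraph k} →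
                   H ↪ G → ContractionSeq d G → ContractionSeq d H
↪-contractionSeq {j = zero}  e (done _ G≤d) = done _ (maxRedDeg-↪ e G≤d)
↪-contractionSeq {j = suc j} e (done _ _)   =
  ⊥-elim (0≢1+n (injective e (Fin1-unique (vertex e zero) (vertex e (suc zero)))))
↪-contractionSeq e (step _ u v u≢v G≤d G/uv)
  with any? (λ a → vertex e a ≟ u) | any? (λ b → vertex e b ≟ v)
... | no u-unhit | _ =
  ↪-contractionSeq (↪-contract-unhit e u≢v (λ ea≡u _ → u-unhit (_ , ea≡u))) G/uv
... | yes _ | no v-unhit =
  ↪-contractionSeq (↪-contract-unhit e u≢v (λ _ eb≡v → v-unhit (_ , eb≡v))) G/uv
↪-contractionSeq {j = zero} e (step _ _ _ u≢v _ _) | yes (a₀ , refl) | yes (b₀ , refl) =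
  ⊥-elim (u≢v (cong (vertex e) (Fin1-unique a₀ b₀)))
↪-contractionSeq {j = suc j} e (step _ _ _ u≢v G≤d G/uv) | yes (a₀ , refl) | yes (b₀ , refl) =
  step _ a₀ b₀ (u≢v ∘ cong (vertex e)) (maxRedDeg-↪ e G≤d) (↪-contractionSeq (↪-contract-hit e u≢v) G/uv)

↪-offDiagonal : ∀ {k} {H G : Trigraph (suc k)} → (∀ {a b} → a ≢ b → H a b ≡ G a b) → H ↪ G
↪-offDiagonal H≐G = record { vertex = id ; injective = id ; dominated = ≡⇒⊑ ∘ H≐G }

edge : Bool → Col
edge b = if b then black else none

edge-nonRed : ∀ b → isRed (edge b) ≡ false
edge-nonRed true  = refl
edge-nonRed false = refl

adjacent : ℕ × ℕ → ℕ × ℕ → Bool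
adjacent (i , j) (i′ , j′) = (∣ i - i′ ∣ + ∣ j - j′ ∣) ≡ᵇ 1

cell : ∀ {m n} → Fin m × Fin n → ℕ × ℕ
cell = Product.map toℕ toℕ

grid-remQuot : ∀ m n (w w′ : Fin (m * n)) →
               grid m n w w′ ≡ edge (adjacent (cell (remQuot {m} n w)) (cell (remQuot {m} n w′)))
grid-remQuot m n w w′ with remQuot {m} n w | remQuot {m} n w′
... | _ | _ = refl

grid-combine : ∀ {m n} (i i′ : Fin m) (j j′ : Fin n) →
               grid m n (combine i j) (combine i′ j′) ≡ edge (adjacent (toℕ i , toℕ j) (toℕ i′ , toℕ j′))
grid-combine {m} {n} i i′ j j′ = trans (grid-remQuot m n _ _)
  (cong₂ (λ x y → edge (adjacent (cell x) (cell y))) (remQuot-combine i j) (remQuot-combine i′ j′))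

remQuot-injective : ∀ {m} n → Injective _≡_ _≡_ (remQuot {m} n)
remQuot-injective {m} n {w} {w′} eq =
  trans (sym (combine-remQuot {m} n w)) (trans (cong (uncurry combine) eq) (combine-remQuot {m} n w′))

grid-↪ : ∀ {m n k} {G : Trigraph k} (f : Fin m × Fin n → Fin k) → Injective _≡_ _≡_ f →
         (∀ {x y} → x ≢ y → edge (adjacent (cell x) (cell y)) ⊑ G (f x) (f y)) → grid m n ↪ G
grid-↪ {m} {n} f f-injective f-dominated = record
  { vertex    = f ∘ remQuot {m} n
  ; injective = remQuot-injective {m} n ∘ f-injective
  ; dominated = λ {w} {w′} w≢w′ →
      ⊑-trans (≡⇒⊑ (grid-remQuot m n w w′)) (f-dominated (w≢w′ ∘ remQuot-injective {m} n))
  }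

grid-↪-wider : ∀ {m n n′} → n ≤ n′ → grid m n ↪ grid m n′
grid-↪-wider {m} {n} {n′} n≤n′ = grid-↪ widen widen-injective λ {(i , j)} {(i′ , j′)} _ →
  ≡⇒⊑ (sym (trans (grid-combine i i′ (inject≤ j n≤n′) (inject≤ j′ n≤n′))
                  (cong₂ (λ y y′ → edge (adjacent (toℕ i , y) (toℕ i′ , y′)))
                         (toℕ-inject≤ j n≤n′) (toℕ-inject≤ j′ n≤n′))))
  where
  widen : Fin m × Fin n → Fin (m * n′)
  widen (i , j) = combine i (inject≤ j n≤n′)
  widen-injective : Injective _≡_ _≡_ widen
  widen-injective {i , j} {i′ , j′} eq with combine-injective i _ i′ _ eq
  ... | i≡i′ , j≡j′ = cong₂ _,_ i≡i′ (inject≤-injective n≤n′ n≤n′ j j′ j≡j′)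

-- A ladder read column by column: position x is adjacent to x + 2, and to x + 1 exactly
-- when x is even (s = false) or odd (s = true); see ladder-columnMajor.
ladderFrom0 : Bool → ℕ → Bool
ladderFrom0 s 1 = not s
ladderFrom0 s 2 = true
ladderFrom0 s _ = false

ladder : Bool → ℕ → ℕ → Bool
ladder s zero    y       = ladderFrom0 s y
ladder s (suc x) zero    = ladderFrom0 s (suc x)
ladder s (suc x) (suc y) = ladder (not s) x y

ladder-columnMajor : ∀ (i i′ : Fin 2) j j′ →
                     ladder false (j * 2 + toℕ i) (j′ * 2 + toℕ i′) ≡ adjacent (toℕ i , j) (toℕ i′ , j′)
ladder-columnMajor i i′ (suc j) (suc j′) = ladder-columnMajor i i′ j j′
ladder-columnMajor zero       zero       zero          zero           = refl
ladder-columnMajor zero       (suc zero) zero          zero           = refl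
ladder-columnMajor (suc zero) zero       zero          zero           = refl
ladder-columnMajor (suc zero) (suc zero) zero          zero           = refl
ladder-columnMajor zero       zero       zero          (suc zero)     = refl
ladder-columnMajor zero       (suc zero) zero          (suc zero)     = refl
ladder-columnMajor (suc zero) zero       zero          (suc zero)     = refl
ladder-columnMajor (suc zero) (suc zero) zero          (suc zero)     = refl
ladder-columnMajor zero       zero       zero          (suc (suc _))  = refl
ladder-columnMajor zero       (suc zero) zero          (suc (suc _))  = refl
ladder-columnMajor (suc zero) zero       zero          (suc (suc _))  = refl
ladder-columnMajor (suc zero) (suc zero) zero          (suc (suc _))  = refl
ladder-columnMajor zero       zero       (suc zero)    zero           = refl
ladder-columnMajor zero       (suc zero) (suc zero)    zero           = refl
ladder-columnMajor (suc zero) zero       (suc zero)    zero           = refl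
ladder-columnMajor (suc zero) (suc zero) (suc zero)    zero           = refl
ladder-columnMajor zero       zero       (suc (suc _)) zero           = refl
ladder-columnMajor zero       (suc zero) (suc (suc _)) zero           = refl
ladder-columnMajor (suc zero) zero       (suc (suc _)) zero           = refl
ladder-columnMajor (suc zero) (suc zero) (suc (suc _)) zero           = refl

headColour : ℕ → Col
headColour 1 = red
headColour 2 = red
headColour _ = none

headedLadderColour : Bool → ℕ → ℕ → Col
headedLadderColour s zero    y       = headColour y
headedLadderColour s (suc x) zero    = headColour (suc x)
headedLadderColour s (suc x) (suc y) = edge (ladder s x y)

headedLadder : Bool → (m : ℕ) → Trigraph (suc m)
headedLadder s m a b = headedLadderColour s (toℕ a) (toℕ b)

maxRedDeg-headedLadder : ∀ s m → MaxRedDegAtMost 2 (headedLadder s m)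
maxRedDeg-headedLadder s m a = subst (_≤ 2) (sym (redDeg≡∑ t a)) (∑-redIndicator≤2 a)
  where
  t : Trigraph (suc m)
  t = headedLadder s m
  ∑-redIndicator≤2 : ∀ a → ∑ (redIndicator t a) ≤ 2
  ∑-redIndicator≤2 zero = ∑-≤-window 1 2 _ (redIndicator≤1 t zero) λ where
    zero                  _               → redIndicator-self t zero
    (suc c)               (inj₁ (s≤s ()))
    (suc zero)            (inj₂ (s≤s ()))
    (suc (suc zero))      (inj₂ (s≤s (s≤s ())))
    c@(suc (suc (suc _))) (inj₂ _)        → redIndicator-nonRed t zero c refl
  ∑-redIndicator≤2 (suc a) = ≤-trans (∑-≤-window 0 1 _ (redIndicator≤1 t (suc a)) λ where
    zero    (inj₁ ())
    zero    (inj₂ ())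
    (suc c) _ → redIndicator-nonRed t (suc a) (suc c) (edge-nonRed _)) (s≤s z≤n)

contract-headedLadder : ∀ s m {a b} → a ≢ b →
                        contract (headedLadder s (suc m)) zero (suc zero) a b ≡ headedLadder (not s) m a b
contract-headedLadder s m {zero}  {zero}  a≢b = ⊥-elim (a≢b refl)
contract-headedLadder s m {zero}  {suc b} _   = head-row (toℕ b)
  where
  head-row : ∀ y → merge (headColour (suc (suc y))) (edge (ladderFrom0 s (suc y))) ≡ headColour (suc y)
  head-row zero          = refl
  head-row (suc zero)    = refl
  head-row (suc (suc _)) = refl
contract-headedLadder s m {suc a} {zero}  _   = head-column (toℕ a)
  where
  head-column : ∀ x → merge (headColour (suc (suc x))) (edge (ladderFrom0 s (suc x))) ≡ headColour (suc x)
  head-column zero          = refl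
  head-column (suc zero)    = refl
  head-column (suc (suc _)) = refl
contract-headedLadder s m {suc a} {suc b} _   = refl

headedLadder-seq : ∀ m s → ContractionSeq 2 (headedLadder s m)
headedLadder-seq zero    s = done _ (maxRedDeg-headedLadder s zero)
headedLadder-seq (suc m) s = step _ zero (suc zero) (λ ()) (maxRedDeg-headedLadder s (suc m))
  (↪-contractionSeq (↪-offDiagonal (contract-headedLadder s m)) (headedLadder-seq m (not s)))

grid-↪-headedLadder : ∀ n → grid 2 n ↪ headedLadder false (n * 2)
grid-↪-headedLadder n = grid-↪ position position-injective λ {(i , j)} {(i′ , j′)} _ →
  ≡⇒⊑ (sym (trans (cong₂ (λ x y → edge (ladder false x y)) (toℕ-position i j) (toℕ-position i′ j′))
                  (cong edge (ladder-columnMajor i i′ (toℕ j) (toℕ j′)))))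
  where
  position : Fin 2 × Fin n → Fin (suc (n * 2))
  position (i , j) = suc (combine j i)
  position-injective : Injective _≡_ _≡_ position
  position-injective {i , j} {i′ , j′} eq with combine-injective j i j′ i′ (suc-injective eq)
  ... | j≡j′ , i≡i′ = cong₂ _,_ i≡i′ j≡j′
  toℕ-position : ∀ (i : Fin 2) (j : Fin n) → toℕ (combine j i) ≡ toℕ j * 2 + toℕ i
  toℕ-position i j = trans (toℕ-combine j i) (cong (_+ toℕ i) (*-comm 2 (toℕ j)))

grid-tww≤2 : ∀ n → ContractionSeq 2 (grid 2 (suc n))
grid-tww≤2 n = ↪-contractionSeq (grid-↪-headedLadder (suc n)) (headedLadder-seq _ false)

maxRedDegAtMost? : ∀ {k} d (t : Trigraph k) → Dec (MaxRedDegAtMost d t)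
maxRedDegAtMost? d t = all? (λ a → redDeg t a ≤? d)

contractionSeq? : ∀ {k} d (t : Trigraph k) → Dec (ContractionSeq d t)
contractionSeq? {zero}        d t = no λ ()
contractionSeq? {suc zero}    d t = map′ (done t) (λ { (done _ t≤d) → t≤d }) (maxRedDegAtMost? d t)
contractionSeq? {suc (suc k)} d t =
  map′ (λ { (t≤d , u , v , u≢v , s) → step t u v u≢v t≤d s })
       (λ { (step _ u v u≢v t≤d s) → t≤d , u , v , u≢v , s })
       (maxRedDegAtMost? d t ×-dec
        any? (λ u → any? (λ v → ¬? (u ≟ v) ×-dec contractionSeq? d (contract t u v))))

grid-tww≤1-small : ∀ {n} → 1 ≤ n → n < 4 → ContractionSeq 1 (grid 2 n)
grid-tww≤1-small {1} _ _ = toWitness {a? = contractionSeq? 1 (grid 2 1)} _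
grid-tww≤1-small {2} _ _ = toWitness {a? = contractionSeq? 1 (grid 2 2)} _
grid-tww≤1-small {3} _ _ = toWitness {a? = contractionSeq? 1 (grid 2 3)} _
grid-tww≤1-small {suc (suc (suc (suc _)))} _ (s≤s (s≤s (s≤s (s≤s ()))))

grid-tww≰1 : ∀ {n} → 4 ≤ n → ¬ ContractionSeq 1 (grid 2 n)
grid-tww≰1 4≤n = toWitnessFalse {a? = contractionSeq? 1 (grid 2 4)} _ ∘ ↪-contractionSeq (grid-↪-wider 4≤n)

proposition7p1 : (n : ℕ) → 1 ≤ n → (TwinWidthIs (grid 2 n) 2 ⇔ 4 ≤ n)
proposition7p1 (suc n) 1≤n = mk⇔
  (λ (_ , tww≰1) → ≮⇒≥ (tww≰1 ∘ grid-tww≤1-small 1≤n))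
  (λ 4≤n → grid-tww≤2 n , grid-tww≰1 4≤n)
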